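{- Let $k_0=0$ and $k_{n+1}=k_n+2^{n+1}-1$ for $n\in\omega$, and for each $n$ let ${}^n2=\{\varphi^n_i:i<2^n\}$ be the enumeration of the $n$-th level of the binary tree ${}^{<\omega}2=\bigcup_{n\in\omega}{}^n2$ in lexicographic order (e.g. $\varphi^2_0=00,\varphi^2_1=01,\varphi^2_2=10,\varphi^2_3=11$). Let $$\Delta=\{\varphi^{n+1}_i{}^\frown\underbrace{0\cdots0}_{k_n+i}: n\in\omega,\ i<2^{n+1}\}.$$ Then $\Delta$ is a dense subset of the reversed tree $\langle {}^{<\omega}2,\supseteq\rangle$ (i.e. every $\varphi\in{}^{<\omega}2$ has an extension in $\Delta$), and $|\Delta\cap{}^n2|=1$ for each positive integer $n$.
   Context: ${}^\frown$ denotes concatenation of finite sequences; $\underbrace{0\cdots0}_{m}$ is the sequence of $m$ zeros. -}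

module Defs where

open import Data.Bool using (Bool; false; true)
open import Data.Nat using (ℕ; zero; suc; _+_; _∸_; _^_)
open import Data.Nat.Properties using (+-identityʳ)
open import Data.Fin using (Fin; toℕ)
open import Data.List using (List; _++_; replicate)
open import Data.Vec using (Vec; []; _∷_; map; cast; lookup; toList)
import Data.Vec as V
open import Data.Product using (Σ; ∃; _×_)
open import Relation.Binary.PropositionalEquality using (_≡_; cong; sym)

-- Finite binary sequences: List Bool, with 0 = false, 1 = true.

k : ℕ → ℕ
k zero = 0
k (suc n) = k n + (2 ^ suc n ∸ 1)

lexLevel : (n : ℕ) → Vec (Vec Bool n) (2 ^ n)
lexLevel zero = [] ∷ []
lexLevel (suc n) =
  cast (cong (2 ^ n +_) (sym (+-identityʳ (2 ^ n))))
       (map (false ∷_) (lexLevel n) V.++ map (true ∷_) (lexLevel n))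

φ : (n : ℕ) → Fin (2 ^ n) → List Bool
φ n i = toList (lookup (lexLevel n) i)

zeros : ℕ → List Bool
zeros m = replicate m false

InΔ : List Bool → Set
InΔ ψ = Σ ℕ λ n → Σ (Fin (2 ^ suc n)) λ i → ψ ≡ φ (suc n) i ++ zeros (k n + toℕ i)

-- ψ extends χ (χ ⊇ ψ in the reversed tree ordering means ψ is below χ)
Extends : List Bool → List Bool → Set
Extends ψ χ = ∃ λ τ → ψ ≡ χ ++ τ

module Submission where

-- Write δ n i = φ^{n+1}_i ⁀ 0⋯0 (k_n + i zeros) for the elements of Δ.
--
-- The enumeration lexLevel lists every binary word of length n,
-- so every nonempty χ of length n+1 is some φ^{n+1}_i, and δ n i extends it
-- by zeros; the empty word is extended by any element of Δ.
--
-- One point per level.  δ n i has length first n + i, where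
-- first n = (n+1) + k_n satisfies first (n+1) = first n + 2^{n+1}.  Hence the
-- lengths of the words δ n i (i < 2^{n+1}) fill the block
-- [first n, first (n+1)) of ℕ, and these blocks tile {1, 2, ...}.  We prove
-- once, for an arbitrary tiling of ℕ by consecutive nonempty blocks, that
-- each number ≥ first 0 has a unique position (block, offset);
-- applied to our blocks, existence gives the element of Δ of length m and
-- uniqueness shows it is the only one.

open import Defs
open import Data.Bool using (Bool; false; true)
open import Data.Nat using (ℕ; zero; suc; _+_; _∸_; _^_; _≤_; _<_; s≤s)
open import Data.Nat.Properties
open import Data.List using (List; []; _∷_; length; _++_)
import Data.List.Properties as List
open import Data.Fin using (Fin; toℕ; fromℕ<)
import Data.Fin as Fin
open import Data.Fin.Properties using (toℕ-fromℕ<; toℕ-injective; toℕ<n)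
open import Data.Vec using (Vec; _∷_; cast; lookup; toList; fromList)
import Data.Vec as Vec
open import Data.Vec.Properties using (length-toList; toList∘fromList)
open import Data.Vec.Membership.Propositional using (_∈_)
open import Data.Vec.Membership.Propositional.Properties using (∈-map⁺; ∈-++⁺ˡ; ∈-++⁺ʳ)
open import Data.Vec.Relation.Unary.Any using (here; there; index)
open import Data.Vec.Relation.Unary.Any.Properties using (lookup-index)
open import Data.Product using (Σ; _×_; _,_)
open import Data.Sum using (inj₁; inj₂)
open import Data.Empty using (⊥-elim)
open import Relation.Binary.Definitions using (tri<; tri≈; tri>)
open import Relation.Binary.PropositionalEquality

∈-cast : {A : Set} {m n : ℕ} {x : A} {xs : Vec A m} .(eq : m ≡ n) →
         x ∈ xs → x ∈ cast eq xs
∈-cast {n = suc _} {xs = _ ∷ _}  eq (here x≡y)  = here x≡y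
∈-cast {n = suc _} {xs = _ ∷ xs} eq (there x∈xs) = there (∈-cast (suc-injective eq) x∈xs)

∈-lexLevel : (n : ℕ) (v : Vec Bool n) → v ∈ lexLevel n
∈-lexLevel zero    Vec.[]      = here refl
∈-lexLevel (suc n) (false ∷ v) = ∈-cast _ (∈-++⁺ˡ (∈-map⁺ (false ∷_) (∈-lexLevel n v)))
∈-lexLevel (suc n) (true ∷ v) =
  ∈-cast _ (∈-++⁺ʳ (Vec.map (false ∷_) (lexLevel n)) (∈-map⁺ (true ∷_) (∈-lexLevel n v)))

φ-onto : (χ : List Bool) → Σ (Fin (2 ^ length χ)) λ i → φ (length χ) i ≡ χ
φ-onto χ = index χ∈ , (begin
    toList (lookup (lexLevel (length χ)) (index χ∈)) ≡⟨ cong toList (sym (lookup-index χ∈)) ⟩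
    toList (fromList χ)                               ≡⟨ toList∘fromList χ ⟩
    χ                                                 ∎)
  where
  open ≡-Reasoning
  χ∈ : fromList χ ∈ lexLevel (length χ)
  χ∈ = ∈-lexLevel (length χ) (fromList χ)

δ : (n : ℕ) → Fin (2 ^ suc n) → List Bool
δ n i = φ (suc n) i ++ zeros (k n + toℕ i)

δ∈Δ : (n : ℕ) (i : Fin (2 ^ suc n)) → InΔ (δ n i)
δ∈Δ n i = n , i , refl

Δ-dense : (χ : List Bool) → Σ (List Bool) λ ψ → InΔ ψ × Extends ψ χ
Δ-dense []      = δ 0 Fin.zero , δ∈Δ 0 Fin.zero , δ 0 Fin.zero , refl
Δ-dense (b ∷ χ) with φ-onto (b ∷ χ)
... | i , φi≡bχ = δ (length χ) i , δ∈Δ (length χ) i ,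
                  zeros (k (length χ) + toℕ i) , cong (_++ zeros (k (length χ) + toℕ i)) φi≡bχ

-- Block n is the interval [first n, first n + size n); consecutive blocks
-- are adjacent and none is empty.
module Blocks (first size : ℕ → ℕ)
              (adjacent : ∀ n → first (suc n) ≡ first n + size n)
              (nonempty : ∀ n → 0 < size n) where

  Position : Set
  Position = Σ ℕ λ n → Fin (size n)

  value : Position → ℕ
  value (n , i) = first n + toℕ i

  first-< : ∀ n → first n < first (suc n)
  first-< n = subst (first n <_) (sym (adjacent n)) (m<m+n (first n) (nonempty n))

  first-mono : ∀ {n n'} → n < n' → first (suc n) ≤ first n'
  first-mono {n' = suc n'} (s≤s n≤n') with m≤n⇒m<n∨m≡n n≤n'
  ... | inj₂ refl = ≤-refl
  ... | inj₁ n<n' = ≤-trans (first-mono n<n') (<⇒≤ (first-< n'))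

  value-< : ∀ {n n'} (i : Fin (size n)) (i' : Fin (size n')) → n < n' →
            value (n , i) < value (n' , i')
  value-< {n} {n'} i i' n<n' = begin-strict
    first n + toℕ i        <⟨ +-monoʳ-< (first n) (toℕ<n i) ⟩
    first n + size n       ≡⟨ adjacent n ⟨
    first (suc n)          ≤⟨ first-mono n<n' ⟩
    first n'               ≤⟨ m≤m+n (first n') (toℕ i') ⟩
    first n' + toℕ i'      ∎
    where open ≤-Reasoning

  value-injective : ∀ p q → value p ≡ value q → p ≡ q
  value-injective (n , i) (n' , i') eq with <-cmp n n'
  ... | tri< n<n' _ _ = ⊥-elim (<-irrefl eq (value-< i i' n<n'))
  ... | tri> _ _ n'<n = ⊥-elim (<-irrefl (sym eq) (value-< i' i n'<n))
  ... | tri≈ _ refl _ = cong (n ,_) (toℕ-injective (+-cancelˡ-≡ (first n) _ _ eq))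

  successor : (p : Position) → Σ Position λ q → value q ≡ suc (value p)
  successor (n , i) with m≤n⇒m<n∨m≡n (toℕ<n i)
  ... | inj₁ i+1<size = (n , fromℕ< i+1<size) , (begin
        first n + toℕ (fromℕ< i+1<size) ≡⟨ cong (first n +_) (toℕ-fromℕ< i+1<size) ⟩
        first n + suc (toℕ i)           ≡⟨ +-suc (first n) (toℕ i) ⟩
        suc (first n + toℕ i)           ∎)
    where open ≡-Reasoning
  ... | inj₂ i+1≡size = (suc n , fromℕ< (nonempty (suc n))) , (begin
        first (suc n) + toℕ (fromℕ< (nonempty (suc n))) ≡⟨ cong (first (suc n) +_) (toℕ-fromℕ< (nonempty (suc n))) ⟩
        first (suc n) + 0                               ≡⟨ +-identityʳ (first (suc n)) ⟩
        first (suc n)                                   ≡⟨ adjacent n ⟩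
        first n + size n                                ≡⟨ cong (first n +_) i+1≡size ⟨
        first n + suc (toℕ i)                           ≡⟨ +-suc (first n) (toℕ i) ⟩
        suc (first n + toℕ i)                           ∎)
    where open ≡-Reasoning

  position-from : ∀ d → Σ Position λ p → value p ≡ first 0 + d
  position-from zero = (0 , fromℕ< (nonempty 0)) , cong (first 0 +_) (toℕ-fromℕ< (nonempty 0))
  position-from (suc d) with position-from d
  ... | p , value≡ with successor p
  ...   | q , value-q = q , trans value-q (trans (cong suc value≡) (sym (+-suc (first 0) d)))

  position : ∀ m → first 0 ≤ m → Σ Position λ p → value p ≡ m
  position m first0≤m with position-from (m ∸ first 0)
  ... | p , eq = p , trans eq (m+[n∸m]≡n first0≤m)

-- first n = (n+1) + k_n, the length of δ n 0.
first : ℕ → ℕ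
first n = suc n + k n

length-δ : (n : ℕ) (i : Fin (2 ^ suc n)) → length (δ n i) ≡ first n + toℕ i
length-δ n i = begin
  length (φ (suc n) i ++ zeros (k n + toℕ i))         ≡⟨ List.length-++ (φ (suc n) i) ⟩
  length (φ (suc n) i) + length (zeros (k n + toℕ i)) ≡⟨ cong₂ _+_ (length-toList (lookup (lexLevel (suc n)) i))
                                                                  (List.length-replicate (k n + toℕ i)) ⟩
  suc n + (k n + toℕ i)                               ≡⟨ +-assoc (suc n) (k n) (toℕ i) ⟨
  first n + toℕ i                                     ∎
  where open ≡-Reasoning

first-adjacent : ∀ n → first (suc n) ≡ first n + 2 ^ suc n
first-adjacent n = begin
  suc (suc n) + (k n + (2 ^ suc n ∸ 1)) ≡⟨ +-suc (suc n) (k n + (2 ^ suc n ∸ 1)) ⟨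
  suc n + suc (k n + (2 ^ suc n ∸ 1))   ≡⟨ cong (suc n +_) (+-suc (k n) (2 ^ suc n ∸ 1)) ⟨
  suc n + (k n + suc (2 ^ suc n ∸ 1))   ≡⟨ cong (λ x → suc n + (k n + x)) (m+[n∸m]≡n 1≤2^[n+1]) ⟩
  suc n + (k n + 2 ^ suc n)             ≡⟨ +-assoc (suc n) (k n) (2 ^ suc n) ⟨
  first n + 2 ^ suc n                   ∎
  where
  open ≡-Reasoning
  1≤2^[n+1] : 1 ≤ 2 ^ suc n
  1≤2^[n+1] = m^n>0 2 (suc n)

open Blocks first (λ n → 2 ^ suc n) first-adjacent (λ n → m^n>0 2 (suc n))

lemma3p1 : ((χ : List Bool) → Σ (List Bool) λ ψ → InΔ ψ × Extends ψ χ)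
    × ((m : ℕ) → 1 ≤ m →
        Σ (List Bool) λ ψ → InΔ ψ × length ψ ≡ m
          × ((χ : List Bool) → InΔ χ → length χ ≡ m → χ ≡ ψ))
lemma3p1 = Δ-dense , one-per-level
  where
  one-per-level : (m : ℕ) → 1 ≤ m →
                  Σ (List Bool) λ ψ → InΔ ψ × length ψ ≡ m
                    × ((χ : List Bool) → InΔ χ → length χ ≡ m → χ ≡ ψ)
  one-per-level m 1≤m with position m 1≤m
  ... | (n , i) , value≡m = δ n i , δ∈Δ n i , trans (length-δ n i) value≡m , unique
    where
    unique : (χ : List Bool) → InΔ χ → length χ ≡ m → χ ≡ δ n i
    unique χ (n' , i' , refl) length≡m
      with value-injective (n' , i') (n , i)
             (trans (sym (length-δ n' i')) (trans length≡m (sym value≡m)))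
    ... | refl = refl
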